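{- Let $n\ge 5$ be an integer and let $\mathcal{H}$ be a Berge-$K_4$-saturated $3$-graph on $n$ vertices with the minimum number of hyperedges (i.e. $e(\mathcal{H})=\mathrm{sat}_3(n,\text{Berge- }K_4)$). Suppose there is a vertex $v_1\in V(\mathcal{H})$ such that $d_{\mathcal{H}}(v_1)=3$, every pair $(v_i,v_j)\in N^d_{\mathcal{H}}(v_1)$ is good, and the pair $(v_1,v_k)$ is good for every $v_k\in N_{\mathcal{H}}(v_1)$. Then there exist four vertices $v_2,v_3,v_4,v_5$ such that $\mathcal{H}[\{v_1,v_2,v_3,v_4,v_5\}]$ contains a copy of $\mathcal{C}^3_5$.
   Context: A $3$-graph is a hypergraph all of whose hyperedges have exactly $3$ vertices. Given a graph $F$, a hypergraph is a Berge-$F$ if there is a bijection $\phi:E(F)\to E(\mathcal{H})$ with $\{u,v\}\subseteq\phi(uv)$ for every $uv\in E(F)$. A hypergraph contains a Berge-$F$ if some subset of its hyperedges forms a Berge-$F$. A $3$-graph $\mathcal{H}$ is Berge-$K_4$-saturated if it contains no Berge-$K_4$ but adding any $3$-set of vertices that is not a hyperedge creates a Berge-$K_4$; $\mathrm{sat}_3(n,\text{Berge- }K_4)$ is the minimum number of hyperedges of such a hypergraph on $n$ vertices. For distinct vertices $u,v$, the pair $(u,v)$ is good if adding the $2$-set $\{u,v\}$ as an edge creates a new Berge-$K_4$, equivalently there exist distinct vertices $w,x\notin\{u,v\}$ and five distinct hyperedges of $\mathcal{H}$ containing respectively $\{u,w\},\{u,x\},\{v,w\},\{v,x\},\{w,x\}$;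 otherwise it is bad. $d_{\mathcal{H}}(v)$ is the number of hyperedges containing $v$; $N^d_{\mathcal{H}}(v)=\{(v_i,v_j): vv_iv_j\in E(\mathcal{H})\}$; $N_{\mathcal{H}}(v)$ is the set of vertices $w\neq v$ lying in a common hyperedge with $v$. $\mathcal{H}[S]$ is the subhypergraph induced on $S$. $\mathcal{C}^3_5$ is the $3$-uniform tight cycle on $w_1,\dots,w_5$ with hyperedges $w_iw_{i+1}w_{i+2}$, $i=1,\dots,5$ (indices mod $5$). -}

module Defs where

open import Data.Nat using (ℕ; zero; suc; _≤_)
open import Data.Bool using (Bool; true; false; _∧_)
open import Data.Fin using (Fin; zero; suc)
open import Data.Fin.Subset using (Subset; _∈_; _∉_; ∣_∣; ⁅_⁆; _∪_)
open import Data.Vec using (Vec; []; _∷_; lookup)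
open import Data.List using (List; []; _∷_; map; _++_; filterᵇ; length)
open import Data.Product using (Σ; ∃; ∃-syntax; _×_; _,_; proj₁; proj₂)
open import Data.Sum using (_⊎_)
open import Relation.Binary.PropositionalEquality using (_≡_; _≢_)
open import Relation.Nullary using (¬_)
open import Function.Definitions using (Injective)

record Hypergraph3 (n : ℕ) : Set where
  field
    E       : Subset n → Bool
    uniform : ∀ s → E s ≡ true → ∣ s ∣ ≡ 3
open Hypergraph3 public

IsEdge : ∀ {n} → Hypergraph3 n → Subset n → Set
IsEdge H s = E H s ≡ true

allSubsets : (n : ℕ) → List (Subset n)
allSubsets zero = [] ∷ []
allSubsets (suc n) = map (true ∷_) (allSubsets n) ++ map (false ∷_) (allSubsets n)

numEdges : ∀ {n} → Hypergraph3 n → ℕ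
numEdges {n} H = length (filterᵇ (E H) (allSubsets n))

degree : ∀ {n} → Hypergraph3 n → Fin n → ℕ
degree {n} H v = length (filterᵇ (λ s → E H s ∧ lookup s v) (allSubsets n))

triple : ∀ {n} → Fin n → Fin n → Fin n → Subset n
triple a b c = ⁅ a ⁆ ∪ (⁅ b ⁆ ∪ ⁅ c ⁆)

K4edge : Fin 6 → Fin 4 × Fin 4
K4edge zero = zero , suc zero
K4edge (suc zero) = zero , suc (suc zero)
K4edge (suc (suc zero)) = zero , suc (suc (suc zero))
K4edge (suc (suc (suc zero))) = suc zero , suc (suc zero)
K4edge (suc (suc (suc (suc zero)))) = suc zero , suc (suc (suc zero))
K4edge (suc (suc (suc (suc (suc zero))))) = suc (suc zero) , suc (suc (suc zero))

ContainsBergeK4 : ∀ {n} → (Subset n → Set) → Set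
ContainsBergeK4 {n} P =
  Σ (Fin 4 → Fin n) λ f → Σ (Fin 6 → Subset n) λ φ →
    Injective _≡_ _≡_ f × Injective _≡_ _≡_ φ ×
    (∀ i → P (φ i) × f (proj₁ (K4edge i)) ∈ φ i × f (proj₂ (K4edge i)) ∈ φ i)

BergeK4Saturated : ∀ {n} → Hypergraph3 n → Set
BergeK4Saturated {n} H =
  ¬ ContainsBergeK4 (IsEdge H) ×
  (∀ (e : Subset n) → ∣ e ∣ ≡ 3 → ¬ IsEdge H e →
     ContainsBergeK4 (λ s → IsEdge H s ⊎ s ≡ e))

IsSatExtremal : ∀ {n} → Hypergraph3 n → Set
IsSatExtremal {n} H =
  BergeK4Saturated H × (∀ (H' : Hypergraph3 n) → BergeK4Saturated H' → numEdges H ≤ numEdges H')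

-- pairs of K_4 minus the edge uv, on vertices u=0, v=1, w=2, x=3:
-- uw, ux, vw, vx, wx
-- Good pair (u,v): distinct w,x ∉ {u,v} and five distinct hyperedges
-- containing {u,w},{u,x},{v,w},{v,x},{w,x} respectively.
Good : ∀ {n} → Hypergraph3 n → Fin n → Fin n → Set
Good {n} H u v =
  u ≢ v × Σ (Fin n) λ w → Σ (Fin n) λ x →
    w ≢ x × w ≢ u × w ≢ v × x ≢ u × x ≢ v ×
    Σ (Fin 5 → Subset n) λ g → Injective _≡_ _≡_ g × (∀ i → IsEdge H (g i)) ×
      (u ∈ g zero × w ∈ g zero) ×
      (u ∈ g (suc zero) × x ∈ g (suc zero)) ×
      (v ∈ g (suc (suc zero)) × w ∈ g (suc (suc zero))) ×
      (v ∈ g (suc (suc (suc zero))) × x ∈ g (suc (suc (suc zero)))) ×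
      (w ∈ g (suc (suc (suc (suc zero)))) × x ∈ g (suc (suc (suc (suc zero)))))

suc5 : Fin 5 → Fin 5
suc5 zero = suc zero
suc5 (suc zero) = suc (suc zero)
suc5 (suc (suc zero)) = suc (suc (suc zero))
suc5 (suc (suc (suc zero))) = suc (suc (suc (suc zero)))
suc5 (suc (suc (suc (suc zero)))) = zero

-- H[S] contains a copy of the tight cycle C^3_5, where S is given by membership
-- predicate: an injective w : Fin 5 → S with all w_i w_{i+1} w_{i+2} edges of H
-- (these triples lie in S, so they are edges of the induced subhypergraph).
ContainsC35In : ∀ {n} → Hypergraph3 n → (Fin n → Set) → Set
ContainsC35In {n} H S =
  Σ (Fin 5 → Fin n) λ w → Injective _≡_ _≡_ w × (∀ i → S (w i)) ×
    (∀ i → IsEdge H (triple (w i) (w (suc5 i)) (w (suc5 (suc5 i)))))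

{-# OPTIONS --safe #-}

-- The link of v₁ consists of the three pairs ab with v₁ab ∈ E(H); by hypothesis every link
-- pair and every spoke v₁a is good.  A witness for a good pair (u,v) is a Berge-K₄ minus uv, so
-- in a Berge-K₄-free H every hyperedge through u and v is one of its five hyperedges and its third
-- vertex is one of the two apices w, x of the witness.  Hence a good pair lies in at most two
-- hyperedges, and the witness can be chosen with any such third vertex as the apex w.
--
-- The witness of a link pair ab with apex v₁ has three hyperedges at v₁, through a, b and
-- through its second apex x ∉ {v₁,a,b}; so two link pairs share a vertex, and the third pair
-- makes the link a star, a triangle, a path, or leaves an isolated pair.  Stars, triangles and
-- isolated pairs contradict the facts above.  For a path pq, qr, rs the witnesses of the spokes
-- v₁q and v₁r give v₁-free hyperedges A ⊇ pq, C ⊇ pr and A′ ⊇ rs, C′ ⊇ qs, and the witness of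
-- pq puts its second apex, r or s, into A.  If it is r, the hyperedges at v₁ with A, C′, A′ form
-- a Berge-K₄ on v₁qrs; if it is s, either C = A′ = prs closes the tight cycle v₁ q p s r, or the
-- hyperedges at v₁ with C, A, A′ form a Berge-K₄ on v₁prs.

module Submission where

open import Defs
open import Data.Bool using (_∧_; T)
import Data.Bool.Properties as Bool
open import Data.Empty using (⊥; ⊥-elim)
open import Data.Fin using (Fin; zero; suc)
open import Data.Fin.Patterns using (0F; 1F; 2F; 3F; 4F; 5F)
open import Data.Fin.Properties using (_≟_; any?; pigeonhole; <⇒≢)
open import Data.Fin.Subset
  using (Subset; _∈_; _∉_; _⊆_; ∣_∣; _-_; ⁅_⁆; Nonempty; inside; outside)
open import Data.Fin.Subset.Properties
  using ( p─⊥≡p; p─q⊆p; x∈p∧x≢y⇒x∈p-y; nonempty?; Empty-unique; ∣⊥∣≡0; ⊆-antisym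
        ; x∈p∪q⁺; x∈p∪q⁻; x∈⁅x⁆; x∈⁅y⁆⇒x≡y)
open import Data.List using (List; []; _∷_; length; filterᵇ)
import Data.List as List
open import Data.List.Membership.Propositional using () renaming (_∈_ to _∈ₗ_)
open import Data.List.Membership.Propositional.Properties
  using (∈-map⁺; ∈-++⁺ˡ; ∈-++⁺ʳ; ∈-filter⁺; ∈-filter⁻)
open import Data.List.Relation.Unary.Any using (here; index)
open import Data.List.Relation.Unary.Any.Properties using (lookup-index)
open import Data.Nat using (ℕ; suc; _+_; _≤_)
open import Data.Nat.Properties using (≮⇒≥; suc-injective)
import Data.Nat.Properties as ℕ
open import Data.Product using (Σ; ∃-syntax; ∃₂; _×_; _,_; proj₁; proj₂)
open import Data.Sum using (_⊎_; inj₁; inj₂; [_,_]′)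
import Data.Sum as Sum
open import Data.Vec using (Vec; []; _∷_; lookup; tabulate; here; there)
open import Data.Vec.Properties using (≡-dec; []=⇒lookup; lookup⇒[]=)
open import Data.Vec.Relation.Unary.All using (All; []; _∷_)
open import Data.Vec.Relation.Unary.All.Properties using (lookup⁺; tabulate⁺)
open import Data.Vec.Relation.Unary.Unique.Propositional using (Unique; []; _∷_)
open import Data.Vec.Relation.Unary.Unique.Propositional.Properties using (lookup-injective)
import Data.Vec.Relation.Unary.Unique.Propositional.Properties as Unique
open import Function using (_∘_; id; case_of_; Equivalence)
open import Function.Definitions using (Injective)
open import Relation.Binary.Definitions using (DecidableEquality)
open import Relation.Binary.PropositionalEquality
  using (_≡_; _≢_; refl; sym; trans; cong; subst; subst₂; ≢-sym; module ≡-Reasoning)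
open import Relation.Nullary using (¬_; yes; no)
open import Relation.Nullary.Decidable using (T?; decidable-stable)

private
  variable
    n : ℕ
    a b c d p q r s u v w y z : Fin n
    S S′ : Subset n

pigeonhole-∈ : ∀ {A : Set} {m} (xs : List A) (f : Fin m → A) → Injective _≡_ _≡_ f →
  (∀ i → f i ∈ₗ xs) → m ≤ length xs
pigeonhole-∈ xs f f-injective f∈xs = ≮⇒≥ λ length<m →
  let i , j , i<j , same-index = pigeonhole length<m (index ∘ f∈xs)
  in <⇒≢ i<j (f-injective (begin
       f i                               ≡⟨ lookup-index (f∈xs i) ⟩
       List.lookup xs (index (f∈xs i))   ≡⟨ cong (List.lookup xs) same-index ⟩
       List.lookup xs (index (f∈xs j))   ≡⟨ lookup-index (f∈xs j) ⟨
       f j                               ∎))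
  where open ≡-Reasoning

length≡1+k⇒∃∈ : ∀ {A : Set} {k} (xs : List A) → length xs ≡ suc k → ∃[ x ] x ∈ₗ xs
length≡1+k⇒∃∈ (x ∷ _) _ = x , here refl

_≟ₛ_ : DecidableEquality (Subset n)
_≟ₛ_ = ≡-dec Bool._≟_

x∈p∧y∉p⇒x≢y : y ∈ S → z ∉ S → y ≢ z
x∈p∧y∉p⇒x≢y y∈S z∉S refl = z∉S y∈S

x∈p∧x∉q⇒p≢q : y ∈ S → y ∉ S′ → S ≢ S′
x∈p∧x∉q⇒p≢q y∈S y∉S′ refl = y∉S′ y∈S

∣p∣≡1+∣p-x∣ : ∀ (P : Subset n) {x} → x ∈ P → ∣ P ∣ ≡ suc ∣ P - x ∣
∣p∣≡1+∣p-x∣ (inside ∷ P)  here        = cong suc (cong ∣_∣ (sym (p─⊥≡p P)))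
∣p∣≡1+∣p-x∣ (outside ∷ P) (there x∈P) = ∣p∣≡1+∣p-x∣ P x∈P
∣p∣≡1+∣p-x∣ (inside ∷ P)  (there x∈P) = cong suc (∣p∣≡1+∣p-x∣ P x∈P)

x∉p-x : ∀ (P : Subset n) x → x ∉ P - x
x∉p-x (inside ∷ P)  zero    ()
x∉p-x (outside ∷ P) zero    ()
x∉p-x (_ ∷ P)       (suc x) (there x∈P-x) = x∉p-x P x x∈P-x

x∈p-y⇒x∈p∧x≢y : ∀ (P : Subset n) {x y} → x ∈ P - y → x ∈ P × x ≢ y
x∈p-y⇒x∈p∧x≢y P {y = y} x∈P-y =
  p─q⊆p P ⁅ y ⁆ x∈P-y , λ { refl → x∉p-x P y x∈P-y }

∣p∣≡1+k⇒nonempty : ∀ (P : Subset n) {k} → ∣ P ∣ ≡ suc k → Nonempty P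
∣p∣≡1+k⇒nonempty {n} P ∣P∣≡1+k with nonempty? P
... | yes nonempty = nonempty
... | no empty =
  case trans (sym ∣P∣≡1+k) (trans (cong ∣_∣ (Empty-unique empty)) (∣⊥∣≡0 n)) of λ ()

record IsTriple (S : Subset n) (a b c : Fin n) : Set where
  field
    ∈₁   : a ∈ S
    ∈₂   : b ∈ S
    ∈₃   : c ∈ S
    ≢₁₂  : a ≢ b
    ≢₁₃  : a ≢ c
    ≢₂₃  : b ≢ c
    only : ∀ {y} → y ∈ S → y ≡ a ⊎ y ≡ b ⊎ y ≡ c
open IsTriple

isTriple : ∣ S ∣ ≡ 3 → a ∈ S → b ∈ S → c ∈ S → a ≢ b → a ≢ c → b ≢ c → IsTriple S a b c
isTriple {S = S} {a} {b} {c} ∣S∣≡3 a∈S b∈S c∈S a≢b a≢c b≢c = record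
  { ∈₁ = a∈S ; ∈₂ = b∈S ; ∈₃ = c∈S ; ≢₁₂ = a≢b ; ≢₁₃ = a≢c ; ≢₂₃ = b≢c ; only = only′ }
  where
  only′ : ∀ {y} → y ∈ S → y ≡ a ⊎ y ≡ b ⊎ y ≡ c
  only′ {y} y∈S with y ≟ a | y ≟ b | y ≟ c
  ... | yes y≡a | _       | _       = inj₁ y≡a
  ... | no _    | yes y≡b | _       = inj₂ (inj₁ y≡b)
  ... | no _    | no _    | yes y≡c = inj₂ (inj₂ y≡c)
  ... | no y≢a  | no y≢b  | no y≢c  = case trans (sym ∣S∣≡3) four-elements of λ ()
    where
    open ≡-Reasoning
    b∈S-a : b ∈ S - a
    b∈S-a = x∈p∧x≢y⇒x∈p-y b∈S (≢-sym a≢b)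
    c∈S-a-b : c ∈ S - a - b
    c∈S-a-b = x∈p∧x≢y⇒x∈p-y (x∈p∧x≢y⇒x∈p-y c∈S (≢-sym a≢c)) (≢-sym b≢c)
    y∈S-a-b-c : y ∈ S - a - b - c
    y∈S-a-b-c = x∈p∧x≢y⇒x∈p-y (x∈p∧x≢y⇒x∈p-y (x∈p∧x≢y⇒x∈p-y y∈S y≢a) y≢b) y≢c
    four-elements : ∣ S ∣ ≡ 4 + ∣ S - a - b - c - y ∣
    four-elements = begin
      ∣ S ∣                       ≡⟨ ∣p∣≡1+∣p-x∣ S a∈S ⟩
      1 + ∣ S - a ∣               ≡⟨ cong suc (∣p∣≡1+∣p-x∣ _ b∈S-a) ⟩
      2 + ∣ S - a - b ∣           ≡⟨ cong (2 +_) (∣p∣≡1+∣p-x∣ _ c∈S-a-b) ⟩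
      3 + ∣ S - a - b - c ∣       ≡⟨ cong (3 +_) (∣p∣≡1+∣p-x∣ _ y∈S-a-b-c) ⟩
      4 + ∣ S - a - b - c - y ∣   ∎

swap₁₂ : IsTriple S a b c → IsTriple S b a c
swap₁₂ t = record
  { ∈₁ = ∈₂ t ; ∈₂ = ∈₁ t ; ∈₃ = ∈₃ t ; ≢₁₂ = ≢-sym (≢₁₂ t) ; ≢₁₃ = ≢₂₃ t ; ≢₂₃ = ≢₁₃ t
  ; only = [ inj₂ ∘ inj₁ , [ inj₁ , inj₂ ∘ inj₂ ]′ ]′ ∘ only t }

swap₂₃ : IsTriple S a b c → IsTriple S a c b
swap₂₃ t = record
  { ∈₁ = ∈₁ t ; ∈₂ = ∈₃ t ; ∈₃ = ∈₂ t ; ≢₁₂ = ≢₁₃ t ; ≢₁₃ = ≢₁₂ t ; ≢₂₃ = ≢-sym (≢₂₃ t)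
  ; only = [ inj₁ , [ inj₂ ∘ inj₂ , inj₂ ∘ inj₁ ]′ ]′ ∘ only t }

rotate : IsTriple S a b c → IsTriple S b c a
rotate = swap₂₃ ∘ swap₁₂

third : IsTriple S a b c → y ∈ S → y ≢ a → y ≢ b → y ≡ c
third t y∈S y≢a y≢b = [ ⊥-elim ∘ y≢a , [ ⊥-elim ∘ y≢b , id ]′ ]′ (only t y∈S)

∉-triple : IsTriple S a b c → y ≢ a → y ≢ b → y ≢ c → y ∉ S
∉-triple t y≢a y≢b y≢c y∈S = y≢c (third t y∈S y≢a y≢b)

IsTriple-⊆ : IsTriple S a b c → IsTriple S′ a b c → S ⊆ S′
IsTriple-⊆ t t′ y∈S with only t y∈S
... | inj₁ refl        = ∈₁ t′
... | inj₂ (inj₁ refl) = ∈₂ t′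
... | inj₂ (inj₂ refl) = ∈₃ t′

IsTriple-unique : IsTriple S a b c → IsTriple S′ a b c → S ≡ S′
IsTriple-unique t t′ = ⊆-antisym (IsTriple-⊆ t t′) (IsTriple-⊆ t′ t)

same-third⇒≡ : IsTriple S a b c → IsTriple S′ a b d → c ≡ d → S ≡ S′
same-third⇒≡ t t′ refl = IsTriple-unique t t′

triple-isTriple : a ≢ b → a ≢ c → b ≢ c → IsTriple (triple a b c) a b c
triple-isTriple {a = a} {b} {c} a≢b a≢c b≢c = record
  { ∈₁ = x∈p∪q⁺ (inj₁ (x∈⁅x⁆ a))
  ; ∈₂ = x∈p∪q⁺ (inj₂ (x∈p∪q⁺ (inj₁ (x∈⁅x⁆ b))))
  ; ∈₃ = x∈p∪q⁺ (inj₂ (x∈p∪q⁺ (inj₂ (x∈⁅x⁆ c))))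
  ; ≢₁₂ = a≢b ; ≢₁₃ = a≢c ; ≢₂₃ = b≢c
  ; only = Sum.map (x∈⁅y⁆⇒x≡y a) (Sum.map (x∈⁅y⁆⇒x≡y b) (x∈⁅y⁆⇒x≡y c) ∘ x∈p∪q⁻ ⁅ b ⁆ ⁅ c ⁆)
           ∘ x∈p∪q⁻ ⁅ a ⁆ _
  }

IsTriple⇒≡triple : IsTriple S a b c → S ≡ triple a b c
IsTriple⇒≡triple t = IsTriple-unique t (triple-isTriple (≢₁₂ t) (≢₁₃ t) (≢₂₃ t))

third-element : ∣ S ∣ ≡ 3 → a ∈ S → b ∈ S → a ≢ b → ∃[ c ] IsTriple S a b c
third-element {S = S} {a} {b} ∣S∣≡3 a∈S b∈S a≢b =
  let c , c∈S-a-b   = ∣p∣≡1+k⇒nonempty (S - a - b) one-left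
      c∈S-a , c≢b   = x∈p-y⇒x∈p∧x≢y (S - a) c∈S-a-b
      c∈S , c≢a     = x∈p-y⇒x∈p∧x≢y S c∈S-a
  in c , isTriple ∣S∣≡3 a∈S b∈S c∈S a≢b (≢-sym c≢a) (≢-sym c≢b)
  where
  open ≡-Reasoning
  one-left : ∣ S - a - b ∣ ≡ 1
  one-left = suc-injective (suc-injective (begin
    2 + ∣ S - a - b ∣   ≡⟨ cong suc (∣p∣≡1+∣p-x∣ _ (x∈p∧x≢y⇒x∈p-y b∈S (≢-sym a≢b))) ⟨
    1 + ∣ S - a ∣       ≡⟨ ∣p∣≡1+∣p-x∣ S a∈S ⟨
    ∣ S ∣               ≡⟨ ∣S∣≡3 ⟩
    3                   ∎))

other-two : ∣ S ∣ ≡ 3 → a ∈ S → ∃₂ λ b c → IsTriple S a b c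
other-two {S = S} {a} ∣S∣≡3 a∈S =
  let b , b∈S-a = ∣p∣≡1+k⇒nonempty (S - a) (suc-injective (trans (sym (∣p∣≡1+∣p-x∣ S a∈S)) ∣S∣≡3))
      b∈S , b≢a = x∈p-y⇒x∈p∧x≢y S b∈S-a
      c , t     = third-element ∣S∣≡3 a∈S b∈S (≢-sym b≢a)
  in b , c , t

∈-allSubsets : ∀ (S : Subset n) → S ∈ₗ allSubsets n
∈-allSubsets []            = here refl
∈-allSubsets (inside ∷ S)  = ∈-++⁺ˡ (∈-map⁺ (inside ∷_) (∈-allSubsets S))
∈-allSubsets (outside ∷ S) = ∈-++⁺ʳ _ (∈-map⁺ (outside ∷_) (∈-allSubsets S))

-- Exchanging the apices w and x of a witness swaps its hyperedges uw ↔ ux and vw ↔ vx.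
swap-apex : Fin 5 → Fin 5
swap-apex 0F = 1F
swap-apex 1F = 0F
swap-apex 2F = 3F
swap-apex 3F = 2F
swap-apex 4F = 4F

swap-apex-involutive : ∀ i → swap-apex (swap-apex i) ≡ i
swap-apex-involutive 0F = refl
swap-apex-involutive 1F = refl
swap-apex-involutive 2F = refl
swap-apex-involutive 3F = refl
swap-apex-involutive 4F = refl

swap-apex-injective : Injective _≡_ _≡_ swap-apex
swap-apex-injective {i} {j} eq =
  trans (sym (swap-apex-involutive i)) (trans (cong swap-apex eq) (swap-apex-involutive j))

module _ (H : Hypergraph3 n) where

  EdgeAt : Fin n → Subset n → Set
  EdgeAt v S = IsEdge H S × v ∈ S

  edges-at : Fin n → List (Subset n)
  edges-at v = filterᵇ (λ S → E H S ∧ lookup S v) (allSubsets n)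

  ∈-edges-at⁺ : EdgeAt v S → S ∈ₗ edges-at v
  ∈-edges-at⁺ (S-edge , v∈S) =
    ∈-filter⁺ (T? ∘ _) (∈-allSubsets _)
      (subst₂ (λ e l → T (e ∧ l)) (sym S-edge) (sym ([]=⇒lookup v∈S)) _)

  ∈-edges-at⁻ : S ∈ₗ edges-at v → EdgeAt v S
  ∈-edges-at⁻ {v = v} S∈ =
    let e , l = Equivalence.to Bool.T-∧ (proj₂ (∈-filter⁻ (T? ∘ _) {xs = allSubsets n} S∈))
    in Equivalence.to Bool.T-≡ e , lookup⇒[]= v _ (Equivalence.to Bool.T-≡ l)

  AtMost3EdgesAt : Fin n → Set
  AtMost3EdgesAt v = ∀ {Ss : Vec (Subset n) 4} → Unique Ss → All (EdgeAt v) Ss → ⊥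

  degree≡3⇒edge : degree H v ≡ 3 → ∃[ S ] EdgeAt v S
  degree≡3⇒edge {v = v} deg = let S , S∈ = length≡1+k⇒∃∈ (edges-at v) deg in S , ∈-edges-at⁻ S∈

  degree≡3⇒at-most-3 : degree H v ≡ 3 → AtMost3EdgesAt v
  degree≡3⇒at-most-3 {v = v} deg {Ss} distinct at-v =
    ℕ.<-irrefl refl (subst (4 ≤_) deg (pigeonhole-∈ (edges-at v) (lookup Ss)
      (lookup-injective distinct _ _) (∈-edges-at⁺ ∘ lookup⁺ at-v)))

  CoveredBy : Fin n → Subset n → Subset n → Subset n → Set
  CoveredBy v P Q R = ∀ {S} → IsEdge H S → v ∈ S → S ≡ P ⊎ S ≡ Q ⊎ S ≡ R

  three-edges-cover : ∀ {P Q R} → AtMost3EdgesAt v → Unique (P ∷ Q ∷ R ∷ []) →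
    All (EdgeAt v) (P ∷ Q ∷ R ∷ []) → CoveredBy v P Q R
  three-edges-cover {P = P} {Q} {R} at-most-3 ((P≢Q ∷ P≢R ∷ []) ∷ (Q≢R ∷ []) ∷ [] ∷ [])
    (P-at ∷ Q-at ∷ R-at ∷ []) {S} S-edge v∈S with S ≟ₛ P | S ≟ₛ Q | S ≟ₛ R
  ... | yes S≡P | _       | _       = inj₁ S≡P
  ... | no _    | yes S≡Q | _       = inj₂ (inj₁ S≡Q)
  ... | no _    | no _    | yes S≡R = inj₂ (inj₂ S≡R)
  ... | no S≢P  | no S≢Q  | no S≢R  = ⊥-elim (at-most-3
    ((P≢Q ∷ P≢R ∷ ≢-sym S≢P ∷ []) ∷ (Q≢R ∷ ≢-sym S≢Q ∷ []) ∷ (≢-sym S≢R ∷ []) ∷ [] ∷ [])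
    (P-at ∷ Q-at ∷ R-at ∷ (S-edge , v∈S) ∷ []))

  CoveredBy-swap₁₃ : ∀ {P Q R} → CoveredBy v P Q R → CoveredBy v R Q P
  CoveredBy-swap₁₃ cover S-edge v∈S = [ inj₂ ∘ inj₂ , [ inj₂ ∘ inj₁ , inj₁ ]′ ]′ (cover S-edge v∈S)

  sole-edge : ∀ {P Q R} → CoveredBy v P Q R → y ∉ Q → y ∉ R → IsEdge H S → v ∈ S → y ∈ S → S ≡ P
  sole-edge cover y∉Q y∉R S-edge v∈S y∈S with cover S-edge v∈S
  ... | inj₁ S≡P         = S≡P
  ... | inj₂ (inj₁ refl) = ⊥-elim (y∉Q y∈S)
  ... | inj₂ (inj₂ refl) = ⊥-elim (y∉R y∈S)

  C₃₅-through : Fin n → Set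
  C₃₅-through v₁ = Σ (Fin n) λ v₂ → Σ (Fin n) λ v₃ → Σ (Fin n) λ v₄ → Σ (Fin n) λ v₅ →
    ContainsC35In H (λ x → x ≡ v₁ ⊎ x ≡ v₂ ⊎ x ≡ v₃ ⊎ x ≡ v₄ ⊎ x ≡ v₅)

  tight-cycle : ∀ {S₀ S₁ S₂ S₃ S₄ w₀ w₁ w₂ w₃ w₄} →
    IsEdge H S₀ → IsEdge H S₁ → IsEdge H S₂ → IsEdge H S₃ → IsEdge H S₄ →
    IsTriple S₀ w₀ w₁ w₂ → IsTriple S₁ w₁ w₂ w₃ → IsTriple S₂ w₂ w₃ w₄ →
    IsTriple S₃ w₃ w₄ w₀ → IsTriple S₄ w₄ w₀ w₁ → C₃₅-through w₀
  tight-cycle {w₀ = w₀} {w₁} {w₂} {w₃} {w₄} e₀ e₁ e₂ e₃ e₄ t₀ t₁ t₂ t₃ t₄ =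
    w₁ , w₂ , w₃ , w₄ , lookup ws , lookup-injective distinct _ _ , on-cycle , edges
    where
    ws : Vec (Fin n) 5
    ws = w₀ ∷ w₁ ∷ w₂ ∷ w₃ ∷ w₄ ∷ []
    distinct : Unique ws
    distinct = (≢₁₂ t₀ ∷ ≢₁₃ t₀ ∷ ≢-sym (≢₁₃ t₃) ∷ ≢-sym (≢₂₃ t₃) ∷ [])
             ∷ (≢₂₃ t₀ ∷ ≢₁₃ t₁ ∷ ≢-sym (≢₁₃ t₄) ∷ [])
             ∷ (≢₂₃ t₁ ∷ ≢₁₃ t₂ ∷ [])
             ∷ (≢₂₃ t₂ ∷ [])
             ∷ [] ∷ []
    on-cycle : ∀ i → let y = lookup ws i in y ≡ w₀ ⊎ y ≡ w₁ ⊎ y ≡ w₂ ⊎ y ≡ w₃ ⊎ y ≡ w₄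
    on-cycle 0F = inj₁ refl
    on-cycle 1F = inj₂ (inj₁ refl)
    on-cycle 2F = inj₂ (inj₂ (inj₁ refl))
    on-cycle 3F = inj₂ (inj₂ (inj₂ (inj₁ refl)))
    on-cycle 4F = inj₂ (inj₂ (inj₂ (inj₂ refl)))
    as-triple : IsEdge H S → IsTriple S a b c → IsEdge H (triple a b c)
    as-triple S-edge t = subst (IsEdge H) (IsTriple⇒≡triple t) S-edge
    edges : ∀ i → IsEdge H (triple (lookup ws i) (lookup ws (suc5 i)) (lookup ws (suc5 (suc5 i))))
    edges 0F = as-triple e₀ t₀
    edges 1F = as-triple e₁ t₁
    edges 2F = as-triple e₂ t₂
    edges 3F = as-triple e₃ t₃
    edges 4F = as-triple e₄ t₄

  bergeK4 : (vs : Vec (Fin n) 4) (es : Vec (Subset n) 6) → Unique vs → Unique es →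
    (∀ i → IsEdge H (lookup es i) × lookup vs (proj₁ (K4edge i)) ∈ lookup es i
                                  × lookup vs (proj₂ (K4edge i)) ∈ lookup es i) →
    ContainsBergeK4 (IsEdge H)
  bergeK4 vs es vs-distinct es-distinct covers =
    lookup vs , lookup es ,
    lookup-injective vs-distinct _ _ , lookup-injective es-distinct _ _ , covers

  -- A witness of Good H u v indexed by its apex w, so that the apex can be prescribed.
  record GoodVia (u v w : Fin n) : Set where
    constructor goodVia
    field
      u≢v         : u ≢ v
      x           : Fin n
      w≢x         : w ≢ x
      w≢u         : w ≢ u
      w≢v         : w ≢ v
      x≢u         : x ≢ u
      x≢v         : x ≢ v
      g           : Fin 5 → Subset n
      g-injective : Injective _≡_ _≡_ g
      g-edge      : ∀ i → IsEdge H (g i)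
      u∈g₀ : u ∈ g 0F
      w∈g₀ : w ∈ g 0F
      u∈g₁ : u ∈ g 1F
      x∈g₁ : x ∈ g 1F
      v∈g₂ : v ∈ g 2F
      w∈g₂ : w ∈ g 2F
      v∈g₃ : v ∈ g 3F
      x∈g₃ : x ∈ g 3F
      w∈g₄ : w ∈ g 4F
      x∈g₄ : x ∈ g 4F

    g-distinct : ∀ {i j} → i ≢ j → g i ≢ g j
    g-distinct i≢j = i≢j ∘ g-injective

  good⇒goodVia : Good H u v → ∃[ w ] GoodVia u v w
  good⇒goodVia (u≢v , w , x , w≢x , w≢u , w≢v , x≢u , x≢v , g , g-injective , g-edge ,
                (u∈g₀ , w∈g₀) , (u∈g₁ , x∈g₁) , (v∈g₂ , w∈g₂) , (v∈g₃ , x∈g₃) , (w∈g₄ , x∈g₄)) =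
    w , goodVia u≢v x w≢x w≢u w≢v x≢u x≢v g g-injective g-edge
                u∈g₀ w∈g₀ u∈g₁ x∈g₁ v∈g₂ w∈g₂ v∈g₃ x∈g₃ w∈g₄ x∈g₄

  other-apex : (W : GoodVia u v w) → GoodVia u v (GoodVia.x W)
  other-apex {w = w} W =
    goodVia u≢v w (≢-sym w≢x) x≢u x≢v w≢u w≢v (g ∘ swap-apex) (swap-apex-injective ∘ g-injective)
            (g-edge ∘ swap-apex) u∈g₁ x∈g₁ u∈g₀ w∈g₀ v∈g₃ x∈g₃ v∈g₂ w∈g₂ x∈g₄ w∈g₄
    where open GoodVia W

  apex∉g₁×g₃ : AtMost3EdgesAt w → (W : GoodVia u v w) → w ∉ GoodVia.g W 1F × w ∉ GoodVia.g W 3F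
  apex∉g₁×g₃ {w = w} at-most-3 W =
    fourth-edge 1F (λ ()) (λ ()) (λ ()) , fourth-edge 3F (λ ()) (λ ()) (λ ())
    where
    open GoodVia W
    fourth-edge : ∀ i → 0F ≢ i → 2F ≢ i → 4F ≢ i → w ∉ g i
    fourth-edge i 0≢i 2≢i 4≢i w∈gᵢ = at-most-3
      ((g-distinct (λ ()) ∷ g-distinct (λ ()) ∷ g-distinct 0≢i ∷ [])
       ∷ (g-distinct (λ ()) ∷ g-distinct 2≢i ∷ []) ∷ (g-distinct 4≢i ∷ []) ∷ [] ∷ [])
      ((g-edge 0F , w∈g₀) ∷ (g-edge 2F , w∈g₂) ∷ (g-edge 4F , w∈g₄) ∷ (g-edge i , w∈gᵢ) ∷ [])

  other-apex∈cover : ∀ {P Q R} → CoveredBy w P Q R → (W : GoodVia u v w) →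
    GoodVia.x W ∈ P ⊎ GoodVia.x W ∈ Q ⊎ GoodVia.x W ∈ R
  other-apex∈cover cover W = Sum.map x∈ (Sum.map x∈ x∈) (cover (g-edge 4F) w∈g₄)
    where
    open GoodVia W
    x∈ : g 4F ≡ S → x ∈ S
    x∈ g₄≡S = subst (x ∈_) g₄≡S x∈g₄

  record FreeWedge (o p q r : Fin n) : Set where
    field
      A C    : Subset n
      A-edge : IsEdge H A
      C-edge : IsEdge H C
      o∉A    : o ∉ A
      o∉C    : o ∉ C
      p∈A    : p ∈ A
      q∈A    : q ∈ A
      p∈C    : p ∈ C
      r∈C    : r ∈ C
      A≢C    : A ≢ C

  module _ (no-K4 : ¬ ContainsBergeK4 (IsEdge H)) where

    edge-through-pair : (W : GoodVia u v w) → IsEdge H S → u ∈ S → v ∈ S →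
      ∃[ i ] S ≡ GoodVia.g W i
    edge-through-pair {u = u} {v} {w} {S} W S-edge u∈S v∈S =
      decidable-stable (any? (λ i → S ≟ₛ g i)) λ S∉g →
        no-K4 (bergeK4 (u ∷ v ∷ w ∷ x ∷ []) (S ∷ tabulate g)
          ((u≢v ∷ ≢-sym w≢u ∷ ≢-sym x≢u ∷ []) ∷ (≢-sym w≢v ∷ ≢-sym x≢v ∷ []) ∷ (w≢x ∷ []) ∷ [] ∷ [])
          (tabulate⁺ (λ i S≡gᵢ → S∉g (i , S≡gᵢ)) ∷ Unique.tabulate⁺ g-injective)
          λ { 0F → S-edge , u∈S , v∈S
            ; 1F → g-edge 0F , u∈g₀ , w∈g₀
            ; 2F → g-edge 1F , u∈g₁ , x∈g₁
            ; 3F → g-edge 2F , v∈g₂ , w∈g₂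
            ; 4F → g-edge 3F , v∈g₃ , x∈g₃
            ; 5F → g-edge 4F , w∈g₄ , x∈g₄ })
      where open GoodVia W

    third-vertex : (W : GoodVia u v w) → IsEdge H S → IsTriple S u v z → z ≡ w ⊎ z ≡ GoodVia.x W
    third-vertex {w = w} {S} {z} W S-edge t = apex (edge-through-pair W S-edge (∈₁ t) (∈₂ t))
      where
      open GoodVia W
      apex : ∃[ i ] S ≡ g i → z ≡ w ⊎ z ≡ x
      apex (0F , refl) = inj₁ (sym (third t w∈g₀ w≢u w≢v))
      apex (1F , refl) = inj₂ (sym (third t x∈g₁ x≢u x≢v))
      apex (2F , refl) = inj₁ (sym (third t w∈g₂ w≢u w≢v))
      apex (3F , refl) = inj₂ (sym (third t x∈g₃ x≢u x≢v))
      apex (4F , refl) = ⊥-elim (w≢x (trans (third t w∈g₄ w≢u w≢v) (sym (third t x∈g₄ x≢u x≢v))))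

    good-via-third : Good H u v → IsEdge H S → IsTriple S u v z → GoodVia u v z
    good-via-third good S-edge t with good⇒goodVia good
    ... | w , W with third-vertex W S-edge t
    ...   | inj₁ refl = W
    ...   | inj₂ refl = other-apex W

    ∌apex⇒∋x : (W : GoodVia u v w) → IsEdge H S → u ∈ S → v ∈ S → w ∉ S → GoodVia.x W ∈ S
    ∌apex⇒∋x {S = S} W S-edge u∈S v∈S w∉S = x-in (edge-through-pair W S-edge u∈S v∈S)
      where
      open GoodVia W
      x-in : ∃[ i ] S ≡ g i → x ∈ S
      x-in (0F , refl) = ⊥-elim (w∉S w∈g₀)
      x-in (1F , refl) = x∈g₁
      x-in (2F , refl) = ⊥-elim (w∉S w∈g₂)
      x-in (3F , refl) = x∈g₃
      x-in (4F , refl) = ⊥-elim (w∉S w∈g₄)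

    good-pair-codegree≤2 : ∀ {S₁ S₂ S₃} → Good H u v → Unique (S₁ ∷ S₂ ∷ S₃ ∷ []) →
      All (λ S → IsEdge H S × u ∈ S × v ∈ S) (S₁ ∷ S₂ ∷ S₃ ∷ []) → ⊥
    good-pair-codegree≤2 good ((S₁≢S₂ ∷ S₁≢S₃ ∷ []) ∷ (S₂≢S₃ ∷ []) ∷ [] ∷ [])
      ((e₁ , u∈S₁ , v∈S₁) ∷ (e₂ , u∈S₂ , v∈S₂) ∷ (e₃ , u∈S₃ , v∈S₃) ∷ [])
      with third-element (uniform H _ e₁) u∈S₁ v∈S₁ (proj₁ good)
         | third-element (uniform H _ e₂) u∈S₂ v∈S₂ (proj₁ good)
         | third-element (uniform H _ e₃) u∈S₃ v∈S₃ (proj₁ good)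
    ... | _ , t₁ | _ , t₂ | _ , t₃
      with third-vertex (good-via-third good e₁ t₁) e₂ t₂
         | third-vertex (good-via-third good e₁ t₁) e₃ t₃
    ...   | inj₁ z₂≡z₁ | _          = S₁≢S₂ (same-third⇒≡ t₁ t₂ (sym z₂≡z₁))
    ...   | _          | inj₁ z₃≡z₁ = S₁≢S₃ (same-third⇒≡ t₁ t₃ (sym z₃≡z₁))
    ...   | inj₂ z₂≡x  | inj₂ z₃≡x  = S₂≢S₃ (same-third⇒≡ t₂ t₃ (trans z₂≡x (sym z₃≡x)))

    good-link-pair-not-isolated : Good H p q → IsEdge H S → IsTriple S v p q →
      (∀ {F} → IsEdge H F → v ∈ F → p ∈ F → F ≡ S) →
      (∀ {F} → IsEdge H F → v ∈ F → q ∈ F → F ≡ S) → ⊥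
    good-link-pair-not-isolated good S-edge t p-only q-only =
      g-distinct {0F} {2F} (λ ())
        (trans (p-only (g-edge 0F) w∈g₀ u∈g₀) (sym (q-only (g-edge 2F) w∈g₂ v∈g₂)))
      where open GoodVia (good-via-third good S-edge (rotate t))

    sole-uw-edge⇒u∉g₂×g₄ : (W : GoodVia u v w) → (∀ {F} → IsEdge H F → u ∈ F → w ∈ F → F ≡ S) →
      u ∉ GoodVia.g W 2F × u ∉ GoodVia.g W 4F
    sole-uw-edge⇒u∉g₂×g₄ {u = u} {w = w} W sole =
      (λ u∈g₂ → clash (λ ()) u∈g₂ w∈g₂) , (λ u∈g₄ → clash (λ ()) u∈g₄ w∈g₄)
      where
      open GoodVia W
      clash : ∀ {i} → 0F ≢ i → u ∈ g i → w ∈ g i → ⊥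
      clash {i} 0≢i u∈gᵢ w∈gᵢ =
        g-distinct 0≢i (trans (sole (g-edge 0F) u∈g₀ w∈g₀) (sym (sole (g-edge i) u∈gᵢ w∈gᵢ)))

    free-wedge : ∀ {Epq Eqr o p q r} → Good H o q → IsEdge H Epq → IsEdge H Eqr →
      IsTriple Epq o p q → IsTriple Eqr o q r → p ≢ r →
      (∀ {F} → IsEdge H F → o ∈ F → p ∈ F → F ≡ Epq) → FreeWedge o p q r
    free-wedge {o = o} {p} {q} {r} good Epq-edge Eqr-edge tpq tqr p≢r p-only = record
      { A = g 2F ; C = g 4F ; A-edge = g-edge 2F ; C-edge = g-edge 4F
      ; o∉A = proj₁ o∉g₂×g₄ ; o∉C = proj₂ o∉g₂×g₄
      ; p∈A = w∈g₂ ; q∈A = v∈g₂ ; p∈C = w∈g₄ ; r∈C = subst (_∈ g 4F) x≡r x∈g₄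
      ; A≢C = g-distinct (λ ()) }
      where
      W : GoodVia o q p
      W = good-via-third good Epq-edge (swap₂₃ tpq)
      open GoodVia W
      x≡r : x ≡ r
      x≡r = [ (λ r≡p → ⊥-elim (p≢r (sym r≡p))) , sym ]′ (third-vertex W Eqr-edge tqr)
      o∉g₂×g₄ : o ∉ g 2F × o ∉ g 4F
      o∉g₂×g₄ = sole-uw-edge⇒u∉g₂×g₄ W p-only

    no-apex-K4 : ∀ {o Ea Eb Ec Fab Fac Fbc} → Unique (o ∷ a ∷ b ∷ c ∷ []) →
      Unique (Ea ∷ Eb ∷ Ec ∷ []) → All (EdgeAt o) (Ea ∷ Eb ∷ Ec ∷ []) → a ∈ Ea → b ∈ Eb → c ∈ Ec →
      Unique (Fab ∷ Fac ∷ Fbc ∷ []) → All (λ F → IsEdge H F × o ∉ F) (Fab ∷ Fac ∷ Fbc ∷ []) →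
      a ∈ Fab → b ∈ Fab → a ∈ Fac → c ∈ Fac → b ∈ Fbc → c ∈ Fbc → ⊥
    no-apex-K4 {a = a} {b} {c} {o} {Ea} {Eb} {Ec} {Fab} {Fac} {Fbc} vertices-distinct
      ((Ea≢Eb ∷ Ea≢Ec ∷ []) ∷ (Eb≢Ec ∷ []) ∷ [] ∷ [])
      ((Ea-edge , o∈Ea) ∷ (Eb-edge , o∈Eb) ∷ (Ec-edge , o∈Ec) ∷ []) a∈Ea b∈Eb c∈Ec
      ((Fab≢Fac ∷ Fab≢Fbc ∷ []) ∷ (Fac≢Fbc ∷ []) ∷ [] ∷ [])
      ((Fab-edge , o∉Fab) ∷ (Fac-edge , o∉Fac) ∷ (Fbc-edge , o∉Fbc) ∷ [])
      a∈Fab b∈Fab a∈Fac c∈Fac b∈Fbc c∈Fbc =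
      no-K4 (bergeK4 (o ∷ a ∷ b ∷ c ∷ []) (Ea ∷ Eb ∷ Ec ∷ Fab ∷ Fac ∷ Fbc ∷ []) vertices-distinct
        ((Ea≢Eb ∷ Ea≢Ec ∷ apart o∈Ea o∉Fab ∷ apart o∈Ea o∉Fac ∷ apart o∈Ea o∉Fbc ∷ [])
         ∷ (Eb≢Ec ∷ apart o∈Eb o∉Fab ∷ apart o∈Eb o∉Fac ∷ apart o∈Eb o∉Fbc ∷ [])
         ∷ (apart o∈Ec o∉Fab ∷ apart o∈Ec o∉Fac ∷ apart o∈Ec o∉Fbc ∷ [])
         ∷ (Fab≢Fac ∷ Fab≢Fbc ∷ []) ∷ (Fac≢Fbc ∷ []) ∷ [] ∷ [])
        λ { 0F → Ea-edge , o∈Ea , a∈Ea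
          ; 1F → Eb-edge , o∈Eb , b∈Eb
          ; 2F → Ec-edge , o∈Ec , c∈Ec
          ; 3F → Fab-edge , a∈Fab , b∈Fab
          ; 4F → Fac-edge , a∈Fac , c∈Fac
          ; 5F → Fbc-edge , b∈Fbc , c∈Fbc })
      where
      apart : ∀ {S S′} → o ∈ S → o ∉ S′ → S ≢ S′
      apart = x∈p∧x∉q⇒p≢q

    module _ (v₁ : Fin n) (at-most-3 : AtMost3EdgesAt v₁)
      (link-good′ : ∀ (vi vj : Fin n) (s : Subset n) → IsEdge H s → v₁ ∈ s → vi ∈ s → vj ∈ s →
                      vi ≢ v₁ → vj ≢ v₁ → vi ≢ vj → Good H vi vj)
      (spoke-good′ : ∀ (vk : Fin n) (s : Subset n) → IsEdge H s → v₁ ∈ s → vk ∈ s → vk ≢ v₁ →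
                       Good H v₁ vk) where

      link-good : IsEdge H S → IsTriple S v₁ a b → Good H a b
      link-good S-edge t =
        link-good′ _ _ _ S-edge (∈₁ t) (∈₂ t) (∈₃ t) (≢-sym (≢₁₂ t)) (≢-sym (≢₁₃ t)) (≢₂₃ t)

      spoke-good : IsEdge H S → IsTriple S v₁ a b → Good H v₁ a
      spoke-good S-edge t = spoke-good′ _ _ S-edge (∈₁ t) (∈₂ t) (≢-sym (≢₁₂ t))

      no-link-triangle : ∀ {Eab Eac Ebc} → IsEdge H Eab → IsEdge H Eac → IsEdge H Ebc →
        IsTriple Eab v₁ a b → IsTriple Eac v₁ a c → IsTriple Ebc v₁ b c → ⊥
      no-link-triangle {a = a} {b} {c} {Eab} {Eac} {Ebc} Eab-edge Eac-edge Ebc-edge tab tac tbc =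
        good-pair-codegree≤2 (link-good Ebc-edge tbc)
          ((x∈p∧x∉q⇒p≢q (∈₁ tbc) v₁∉g₁ ∷ x∈p∧x∉q⇒p≢q (∈₁ tbc) v₁∉g₃ ∷ [])
           ∷ (Wab.g-distinct (λ ()) ∷ []) ∷ [] ∷ [])
          (  (Ebc-edge , ∈₂ tbc , ∈₃ tbc) ∷ (Wab.g-edge 1F , b∈g₁ , c∈g₁)
           ∷ (Wab.g-edge 3F , Wab.v∈g₃ , c∈g₃) ∷ [])
        where
        a∉Ebc : a ∉ Ebc
        a∉Ebc = ∉-triple tbc (≢-sym (≢₁₂ tab)) (≢₂₃ tab) (≢₂₃ tac)
        cover : CoveredBy v₁ Eab Eac Ebc
        cover = three-edges-cover at-most-3
          ((x∈p∧x∉q⇒p≢q (∈₃ tab) (∉-triple tac (≢-sym (≢₁₃ tab)) (≢-sym (≢₂₃ tab)) (≢₂₃ tbc))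
            ∷ x∈p∧x∉q⇒p≢q (∈₂ tab) a∉Ebc ∷ [])
           ∷ (x∈p∧x∉q⇒p≢q (∈₂ tac) a∉Ebc ∷ []) ∷ [] ∷ [])
          ((Eab-edge , ∈₁ tab) ∷ (Eac-edge , ∈₁ tac) ∷ (Ebc-edge , ∈₁ tbc) ∷ [])
        Wab : GoodVia a b v₁
        Wab = good-via-third (link-good Eab-edge tab) Eab-edge (rotate tab)
        module Wab = GoodVia Wab
        Wac : GoodVia a c v₁
        Wac = good-via-third (link-good Eac-edge tac) Eac-edge (rotate tac)
        module Wac = GoodVia Wac
        Wab-x≡c : Wab.x ≡ c
        Wab-x≡c with other-apex∈cover cover Wab
        ... | inj₁ x∈Eab        = ⊥-elim (∉-triple tab (≢-sym Wab.w≢x) Wab.x≢u Wab.x≢v x∈Eab)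
        ... | inj₂ (inj₁ x∈Eac) = third tac x∈Eac (≢-sym Wab.w≢x) Wab.x≢u
        ... | inj₂ (inj₂ x∈Ebc) = third tbc x∈Ebc (≢-sym Wab.w≢x) Wab.x≢v
        Wac-x≡b : Wac.x ≡ b
        Wac-x≡b with other-apex∈cover cover Wac
        ... | inj₁ x∈Eab        = third tab x∈Eab (≢-sym Wac.w≢x) Wac.x≢u
        ... | inj₂ (inj₁ x∈Eac) = ⊥-elim (∉-triple tac (≢-sym Wac.w≢x) Wac.x≢u Wac.x≢v x∈Eac)
        ... | inj₂ (inj₂ x∈Ebc) = third (swap₂₃ tbc) x∈Ebc (≢-sym Wac.w≢x) Wac.x≢v
        v₁∉g₁ : v₁ ∉ Wab.g 1F
        v₁∉g₁ = proj₁ (apex∉g₁×g₃ at-most-3 Wab)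
        v₁∉g₃ : v₁ ∉ Wab.g 3F
        v₁∉g₃ = proj₂ (apex∉g₁×g₃ at-most-3 Wab)
        c∈g₁ : c ∈ Wab.g 1F
        c∈g₁ = subst (_∈ Wab.g 1F) Wab-x≡c Wab.x∈g₁
        c∈g₃ : c ∈ Wab.g 3F
        c∈g₃ = subst (_∈ Wab.g 3F) Wab-x≡c Wab.x∈g₃
        b∈g₁ : b ∈ Wab.g 1F
        b∈g₁ = subst (_∈ Wab.g 1F) Wac-x≡b (∌apex⇒∋x Wac (Wab.g-edge 1F) Wab.u∈g₁ c∈g₁ v₁∉g₁)

      module LinkPath {Epq Eqr Ers p q r s}
        (Epq-edge : IsEdge H Epq) (Eqr-edge : IsEdge H Eqr) (Ers-edge : IsEdge H Ers)
        (tpq : IsTriple Epq v₁ p q) (tqr : IsTriple Eqr v₁ q r) (trs : IsTriple Ers v₁ r s)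
        (p≢r : p ≢ r) (p≢s : p ≢ s) (q≢s : q ≢ s) where

        p≢q : p ≢ q
        p≢q = ≢₂₃ tpq
        q≢r : q ≢ r
        q≢r = ≢₂₃ tqr
        r≢s : r ≢ s
        r≢s = ≢₂₃ trs

        p∉Eqr : p ∉ Eqr
        p∉Eqr = ∉-triple tqr (≢-sym (≢₁₂ tpq)) p≢q p≢r
        p∉Ers : p ∉ Ers
        p∉Ers = ∉-triple trs (≢-sym (≢₁₂ tpq)) p≢r p≢s
        q∉Ers : q ∉ Ers
        q∉Ers = ∉-triple trs (≢-sym (≢₁₃ tpq)) q≢r q≢s
        s∉Epq : s ∉ Epq
        s∉Epq = ∉-triple tpq (≢-sym (≢₁₃ trs)) (≢-sym p≢s) (≢-sym q≢s)
        s∉Eqr : s ∉ Eqr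
        s∉Eqr = ∉-triple tqr (≢-sym (≢₁₃ trs)) (≢-sym q≢s) (≢-sym r≢s)

        spokes-distinct : Unique (Epq ∷ Eqr ∷ Ers ∷ [])
        spokes-distinct = (x∈p∧x∉q⇒p≢q (∈₂ tpq) p∉Eqr ∷ x∈p∧x∉q⇒p≢q (∈₂ tpq) p∉Ers ∷ [])
                        ∷ (x∈p∧x∉q⇒p≢q (∈₂ tqr) q∉Ers ∷ []) ∷ [] ∷ []

        spokes : All (EdgeAt v₁) (Epq ∷ Eqr ∷ Ers ∷ [])
        spokes = (Epq-edge , ∈₁ tpq) ∷ (Eqr-edge , ∈₁ tqr) ∷ (Ers-edge , ∈₁ trs) ∷ []

        cover : CoveredBy v₁ Epq Eqr Ers
        cover = three-edges-cover at-most-3 spokes-distinct spokes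

        M : FreeWedge v₁ p q r
        M = free-wedge (spoke-good Epq-edge (swap₂₃ tpq)) Epq-edge Eqr-edge tpq tqr p≢r
              (sole-edge cover p∉Eqr p∉Ers)
        module M = FreeWedge M

        M′ : FreeWedge v₁ s r q
        M′ = free-wedge (spoke-good Ers-edge trs) Ers-edge Eqr-edge (swap₂₃ trs) (swap₂₃ tqr)
               (≢-sym q≢s) (sole-edge (CoveredBy-swap₁₃ cover) s∉Eqr s∉Epq)
        module M′ = FreeWedge M′

        W : GoodVia p q v₁
        W = good-via-third (link-good Epq-edge tpq) Epq-edge (rotate tpq)
        module W = GoodVia W

        W-x≡r⊎s : W.x ≡ r ⊎ W.x ≡ s
        W-x≡r⊎s with other-apex∈cover cover W
        ... | inj₁ x∈Epq        = ⊥-elim (∉-triple tpq (≢-sym W.w≢x) W.x≢u W.x≢v x∈Epq)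
        ... | inj₂ (inj₁ x∈Eqr) = inj₁ (third tqr x∈Eqr (≢-sym W.w≢x) W.x≢v)
        ... | inj₂ (inj₂ x∈Ers) = [ ⊥-elim ∘ ≢-sym W.w≢x , id ]′ (only trs x∈Ers)

        r∈A⊎s∈A : r ∈ M.A ⊎ s ∈ M.A
        r∈A⊎s∈A = Sum.map (λ x≡r → subst (_∈ M.A) x≡r x∈A) (λ x≡s → subst (_∈ M.A) x≡s x∈A)
                           W-x≡r⊎s
          where
          x∈A : W.x ∈ M.A
          x∈A = ∌apex⇒∋x W M.A-edge M.p∈A M.q∈A M.o∉A

        r∉A : r ∉ M.A
        r∉A r∈A = no-apex-K4
          ((≢₁₃ tpq ∷ ≢₁₃ tqr ∷ ≢₁₃ trs ∷ []) ∷ (q≢r ∷ q≢s ∷ []) ∷ (r≢s ∷ []) ∷ [] ∷ [])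
          spokes-distinct spokes (∈₃ tpq) (∈₃ tqr) (∈₃ trs)
          ((≢-sym (x∈p∧x∉q⇒p≢q M′.p∈C s∉A) ∷ ≢-sym (x∈p∧x∉q⇒p≢q M′.p∈A s∉A) ∷ [])
           ∷ (≢-sym M′.A≢C ∷ []) ∷ [] ∷ [])
          ((M.A-edge , M.o∉A) ∷ (M′.C-edge , M′.o∉C) ∷ (M′.A-edge , M′.o∉A) ∷ [])
          M.q∈A r∈A M′.r∈C M′.p∈C M′.q∈A M′.p∈A
          where
          s∉A : s ∉ M.A
          s∉A = ∉-triple (isTriple (uniform H _ M.A-edge) M.p∈A M.q∈A r∈A p≢q p≢r q≢r)
                  (≢-sym p≢s) (≢-sym q≢s) (≢-sym r≢s)

        s∈A : s ∈ M.A
        s∈A = [ ⊥-elim ∘ r∉A , id ]′ r∈A⊎s∈A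

        c₃₅ : C₃₅-through v₁
        c₃₅ with M.C ≟ₛ M′.A
        ... | yes C≡A′ = tight-cycle Epq-edge M.A-edge M.C-edge Ers-edge Eqr-edge
                (swap₂₃ tpq) (swap₁₂ tA) (swap₂₃ tC) (swap₁₂ (rotate trs)) (rotate (rotate tqr))
          where
          tA : IsTriple M.A p q s
          tA = isTriple (uniform H _ M.A-edge) M.p∈A M.q∈A s∈A p≢q p≢s q≢s
          tC : IsTriple M.C p r s
          tC = isTriple (uniform H _ M.C-edge) M.p∈C M.r∈C (subst (s ∈_) (sym C≡A′) M′.p∈A)
                 p≢r p≢s r≢s
        ... | no C≢A′ = ⊥-elim (no-apex-K4
                ((≢₁₂ tpq ∷ ≢₁₃ tqr ∷ ≢₁₃ trs ∷ []) ∷ (p≢r ∷ p≢s ∷ []) ∷ (r≢s ∷ []) ∷ [] ∷ [])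
                spokes-distinct spokes (∈₂ tpq) (∈₃ tqr) (∈₃ trs)
                ((≢-sym M.A≢C ∷ C≢A′ ∷ []) ∷ (≢-sym (x∈p∧x∉q⇒p≢q M′.q∈A r∉A) ∷ []) ∷ [] ∷ [])
                ((M.C-edge , M.o∉C) ∷ (M.A-edge , M.o∉A) ∷ (M′.A-edge , M′.o∉A) ∷ [])
                M.p∈C M.r∈C M.p∈A s∈A M′.q∈A M′.p∈A)

      c₃₅-from-link-cherry : ∀ {Eab Eac K} → IsEdge H Eab → IsEdge H Eac → IsEdge H K →
        IsTriple Eab v₁ a b → IsTriple Eac v₁ a c → IsTriple K v₁ d y →
        Eac ≢ Eab → K ≢ Eac → d ∉ Eab → C₃₅-through v₁
      c₃₅-from-link-cherry {a = a} {b} {c} {d} {y} {Eab} {Eac} {K}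
                           Eab-edge Eac-edge K-edge tab tac tdy Eac≢Eab K≢Eac d∉Eab = by-cases
        where
        a≢d : a ≢ d
        a≢d = x∈p∧y∉p⇒x≢y (∈₂ tab) d∉Eab
        b≢d : b ≢ d
        b≢d = x∈p∧y∉p⇒x≢y (∈₃ tab) d∉Eab
        c≢b : c ≢ b
        c≢b c≡b = Eac≢Eab (same-third⇒≡ tac tab c≡b)
        distinct : Unique (Eab ∷ Eac ∷ K ∷ [])
        distinct = (≢-sym Eac≢Eab ∷ ≢-sym (x∈p∧x∉q⇒p≢q (∈₂ tdy) d∉Eab) ∷ [])
                 ∷ (≢-sym K≢Eac ∷ []) ∷ [] ∷ []
        cover : CoveredBy v₁ K Eac Eab
        cover = CoveredBy-swap₁₃ (three-edges-cover at-most-3 distinct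
          ((Eab-edge , ∈₁ tab) ∷ (Eac-edge , ∈₁ tac) ∷ (K-edge , ∈₁ tdy) ∷ []))
        by-cases : C₃₅-through v₁
        by-cases with y ≟ a
        ... | yes refl = ⊥-elim (good-pair-codegree≤2 (spoke-good Eab-edge tab) distinct
                (  (Eab-edge , ∈₁ tab , ∈₂ tab) ∷ (Eac-edge , ∈₁ tac , ∈₂ tac)
                 ∷ (K-edge , ∈₁ tdy , ∈₃ tdy) ∷ []))
        ... | no y≢a with y ≟ b | d ≟ c
        ...   | yes refl | yes refl =
          ⊥-elim (no-link-triangle Eab-edge Eac-edge K-edge tab tac (swap₂₃ tdy))
        ...   | yes refl | no d≢c   =
          LinkPath.c₃₅ Eac-edge Eab-edge K-edge (swap₂₃ tac) tab (swap₂₃ tdy) c≢b (≢-sym d≢c) a≢d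
        ...   | no y≢b   | yes refl =
          LinkPath.c₃₅ Eab-edge Eac-edge K-edge (swap₂₃ tab) tac tdy
            (≢-sym c≢b) (≢-sym y≢b) (≢-sym y≢a)
        ...   | no y≢b   | no d≢c with y ≟ c
        ...     | yes refl =
          LinkPath.c₃₅ Eab-edge Eac-edge K-edge (swap₂₃ tab) tac (swap₂₃ tdy) (≢-sym c≢b) b≢d a≢d
        ...     | no y≢c = ⊥-elim (good-link-pair-not-isolated (link-good K-edge tdy) K-edge tdy
                    (sole-edge cover (∉-triple tac (≢-sym (≢₁₂ tdy)) (≢-sym a≢d) d≢c) d∉Eab)
                    (sole-edge cover (∉-triple tac (≢-sym (≢₁₃ tdy)) y≢a y≢c)
                                     (∉-triple tab (≢-sym (≢₁₃ tdy)) y≢a y≢b)))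

      -- g₀ ∋ a and g₂ ∋ b are distinct hyperedges at v₁, so one of them is not Eab; g₄ is a
      -- third hyperedge at v₁, through the second apex x ∉ Eab.
      c₃₅-from-link-pair : IsEdge H S → IsTriple S v₁ a b → C₃₅-through v₁
      c₃₅-from-link-pair {S = Eab} Eab-edge tab = by-cases
        where
        open GoodVia (good-via-third (link-good Eab-edge tab) Eab-edge (rotate tab))
        x∉Eab : x ∉ Eab
        x∉Eab = ∉-triple tab (≢-sym w≢x) x≢u x≢v
        through : ∀ {a′ b′} i → IsTriple Eab v₁ a′ b′ → v₁ ∈ g i → a′ ∈ g i → g i ≢ Eab → 4F ≢ i →
          C₃₅-through v₁
        through i t v₁∈gᵢ a′∈gᵢ gᵢ≢Eab 4≢i =
          c₃₅-from-link-cherry Eab-edge (g-edge i) (g-edge 4F) t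
            (proj₂ (third-element (uniform H _ (g-edge i)) v₁∈gᵢ a′∈gᵢ (≢₁₂ t)))
            (proj₂ (third-element (uniform H _ (g-edge 4F)) w∈g₄ x∈g₄ w≢x))
            gᵢ≢Eab (g-distinct 4≢i) x∉Eab
        by-cases : C₃₅-through v₁
        by-cases with g 0F ≟ₛ Eab
        ... | no g₀≢Eab  = through 0F tab w∈g₀ u∈g₀ g₀≢Eab (λ ())
        ... | yes g₀≡Eab = through 2F (swap₂₃ tab) w∈g₂ v∈g₂
                             (λ g₂≡Eab → g-distinct (λ ()) (trans g₂≡Eab (sym g₀≡Eab))) (λ ())

lemma3p1 : (n : ℕ) → 5 ≤ n → (H : Hypergraph3 n) → IsSatExtremal H →
    (v₁ : Fin n) → degree H v₁ ≡ 3 →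
    (∀ (vi vj : Fin n) (s : Subset n) → IsEdge H s → v₁ ∈ s → vi ∈ s → vj ∈ s →
       vi ≢ v₁ → vj ≢ v₁ → vi ≢ vj → Good H vi vj) →
    (∀ (vk : Fin n) (s : Subset n) → IsEdge H s → v₁ ∈ s → vk ∈ s → vk ≢ v₁ →
       Good H v₁ vk) →
    Σ (Fin n) λ v₂ → Σ (Fin n) λ v₃ → Σ (Fin n) λ v₄ → Σ (Fin n) λ v₅ →
      ContainsC35In H (λ x → x ≡ v₁ ⊎ x ≡ v₂ ⊎ x ≡ v₃ ⊎ x ≡ v₄ ⊎ x ≡ v₅)
lemma3p1 n _ H ((no-K4 , _) , _) v₁ deg link-good spoke-good =
  let S , S-edge , v₁∈S = degree≡3⇒edge H deg
      _ , _ , t         = other-two (uniform H S S-edge) v₁∈S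
  in c₃₅-from-link-pair H no-K4 v₁ (degree≡3⇒at-most-3 H deg) link-good spoke-good S-edge t
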